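{- For all formulae $A,B$, the formula $\top^*\land(A*B)\to A$ is provable in $LS_{PASL}+IU$.
   Context: Formulae: built from propositional variables and constants $\top,\bot,\top^*$ using $\land,\to,*,-\!*$. Labels: countably infinite set $\mathcal{L}$ with distinguished $\epsilon$. Relational atoms: $(a,b\triangleright c)$, $a=b$, $a\neq b$. Sequents $\mathcal{G};\Gamma\vdash\Delta$: finite set $\mathcal{G}$ of relational atoms, finite sets $\Gamma,\Delta$ of labelled formulae $a:A$. $E(\mathcal{G})\vdash a=b$ iff $(a,b)$ is in the smallest equivalence relation on $\mathcal{L}$ containing all $(c,d)$ with $c=d\in\mathcal{G}$. $LS$ (no cut): $(id)$ $\mathcal{G};\Gamma,a:p\vdash b:p,\Delta$ if $E(\mathcal{G})\vdash a=b$; $(\bot L)$; $(\top R)$; $(\top^*R)$ $\mathcal{G};\Gamma\vdash a:\top^*,\Delta$ if $E(\mathcal{G})\vdash a=\epsilon$; $(NEq)$ closes $\mathcal{G};\Gamma\vdash\Delta$ if $a\neq b\in\mathcal{G}$ and $E(\mathcal{G})\vdash a=b$; $(\top^*L)$ from $\mathcal{G}\cup\{a=\epsilon\};\Gamma\vdash\Delta$ infer $\mathcal{G};\Gamma,a:\top^*\vdash\Delta$; standard $\land L,\land R,\to L,\to R$ at one label; $(*L)$ from $\mathcal{G}\cup\{(x,y\triangleright z)\};\Gamma,x:A,y:B\vdash\Delta$ infer $\mathcal{G};\Gamma,z:A*B\vdash\Delta$ ($x,y$ fresh); $(-\!*R)$ from $\mathcal{G}\cup\{(x,z\triangleright y)\};\Gamma,x:A\vdash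 y:B,\Delta$ infer $\mathcal{G};\Gamma\vdash z:A-\!*B,\Delta$ ($x,y$ fresh); $(*R)$ if $(x,y\triangleright z)\in\mathcal{G}$ and $E(\mathcal{G})\vdash z=w$, from $\mathcal{G};\Gamma\vdash x:A,w:A*B,\Delta$ and $\mathcal{G};\Gamma\vdash y:B,w:A*B,\Delta$ infer $\mathcal{G};\Gamma\vdash w:A*B,\Delta$; $(-\!*L)$ if $(x,w\triangleright y)\in\mathcal{G}$ and $E(\mathcal{G})\vdash z=w$, from $\mathcal{G};\Gamma,z:A-\!*B\vdash x:A,\Delta$ and $\mathcal{G};\Gamma,z:A-\!*B,y:B\vdash\Delta$ infer $\mathcal{G};\Gamma,z:A-\!*B\vdash\Delta$; $(EM)$ from $\mathcal{G}\cup\{a=b\};\Gamma\vdash\Delta$ and $\mathcal{G}\cup\{a\neq b\};\Gamma\vdash\Delta$ infer $\mathcal{G};\Gamma\vdash\Delta$. A frame axiom $\forall\vec x.(s_1=t_1\&\cdots\& s_p=t_p\& S_1\&\cdots\& S_k\Rightarrow\exists y_1..y_n.(T_1\&\cdots\& T_l))$ gives the structural rule: for a substitution $\theta$ of labels for $\vec x$ (fixing $\epsilon$) with each $S_i\theta\in\mathcal{G}$ and $E(\mathcal{G})\vdash s_i\theta=t_i\theta$, and distinct fresh labels $b_j\neq\epsilon$ with $\sigma=[b_j/y_j]$: from $\mathcal{G}\cup\{T_i\theta\sigma\}_i;\Gamma\vdash\Delta$ infer $\mathcal{G};\Gamma\vdash\Delta$. $LS_{PASL}$ = $LS$ plus rules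 for: (E) $y=\epsilon\&(x,y\triangleright z)\Rightarrow x=z$; (U) $(x,\epsilon\triangleright x)$; (Com) $(x,y\triangleright z)\Rightarrow(y,x\triangleright z)$; (A) $y=y'\&(u,y\triangleright x)\&(v,w\triangleright y')\Rightarrow\exists z.((z,w\triangleright x)\&(u,v\triangleright z))$; (P) $w=w'\&x=x'\&(w,x\triangleright y)\&(w',x'\triangleright z)\Rightarrow y=z$; (C) $x=x'\&z=z'\&(x,y\triangleright z)\&(x',w\triangleright z')\Rightarrow y=w$ (all variables universally quantified). $IU$ is the rule synthesised from indivisible unit $\forall h_1,h_2,h_0.\ h_0=\epsilon\ \&\ (h_1,h_2\triangleright h_0)\Rightarrow h_1=\epsilon$, i.e. if $(x,y\triangleright z)\in\mathcal{G}$ and $E(\mathcal{G})\vdash z=\epsilon$, from $\mathcal{G}\cup\{x=\epsilon\};\Gamma\vdash\Delta$ infer $\mathcal{G};\Gamma\vdash\Delta$. A formula $F$ is provable if $\emptyset;\emptyset\vdash w:F$ has a finite derivation for a label $w\neq\epsilon$. -}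

module Defs where

open import Data.Nat using (ℕ; zero)
open import Data.List using (List; []; _∷_; _++_; concatMap)
open import Data.List.Membership.Propositional using (_∈_; _∉_)
open import Data.List.Relation.Binary.Subset.Propositional using (_⊆_)
open import Data.Product using (Σ; _×_; _,_)
open import Relation.Binary.PropositionalEquality using (_≡_; _≢_)

infixr 7 _⋆_
infixr 6 _∧_
infixr 5 _⇒_ _-⋆_

data Formula : Set where
  var   : ℕ → Formula
  ⊤ᶠ    : Formula
  ⊥ᶠ    : Formula
  ⊤*    : Formula
  _∧_   : Formula → Formula → Formula
  _⇒_   : Formula → Formula → Formula
  _⋆_   : Formula → Formula → Formula
  _-⋆_  : Formula → Formula → Formula

Label : Set
Label = ℕ

ε : Label
ε = zero

data RAtom : Set where
  tern : Label → Label → Label → RAtom   -- (a , b ▷ c)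
  eq   : Label → Label → RAtom
  neq  : Label → Label → RAtom

LFormula : Set
LFormula = Label × Formula

-- Finite sets are represented by lists; derivability is closed under
-- equality of the underlying sets (rule `reorg` below).
Rel : Set
Rel = List RAtom

Ctx : Set
Ctx = List LFormula

data E (G : Rel) : Label → Label → Set where
  e-base  : ∀ {a b} → eq a b ∈ G → E G a b
  e-refl  : ∀ {a} → E G a a
  e-sym   : ∀ {a b} → E G a b → E G b a
  e-trans : ∀ {a b c} → E G a b → E G b c → E G a c

labelsR : RAtom → List Label
labelsR (tern a b c) = a ∷ b ∷ c ∷ []
labelsR (eq a b)     = a ∷ b ∷ []
labelsR (neq a b)    = a ∷ b ∷ []

labelsF : LFormula → List Label
labelsF (a , _) = a ∷ []

labelsSeq : Rel → Ctx → Ctx → List Label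
labelsSeq G Γ Δ = concatMap labelsR G ++ concatMap labelsF Γ ++ concatMap labelsF Δ

Fresh : Label → Rel → Ctx → Ctx → Set
Fresh x G Γ Δ = (x ≢ ε) × (x ∉ labelsSeq G Γ Δ)

data _⨾_⊢_ : Rel → Ctx → Ctx → Set where
  reorg : ∀ {G G' Γ Γ' Δ Δ'} →
          G ⊆ G' → G' ⊆ G → Γ ⊆ Γ' → Γ' ⊆ Γ → Δ ⊆ Δ' → Δ' ⊆ Δ →
          G ⨾ Γ ⊢ Δ → G' ⨾ Γ' ⊢ Δ'
  id    : ∀ {G Γ Δ a b p} → (a , var p) ∈ Γ → (b , var p) ∈ Δ → E G a b → G ⨾ Γ ⊢ Δ
  ⊥L    : ∀ {G Γ Δ a} → (a , ⊥ᶠ) ∈ Γ → G ⨾ Γ ⊢ Δ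
  ⊤R    : ∀ {G Γ Δ a} → (a , ⊤ᶠ) ∈ Δ → G ⨾ Γ ⊢ Δ
  ⊤*R   : ∀ {G Γ Δ a} → (a , ⊤*) ∈ Δ → E G a ε → G ⨾ Γ ⊢ Δ
  NEq   : ∀ {G Γ Δ a b} → neq a b ∈ G → E G a b → G ⨾ Γ ⊢ Δ
  ⊤*L   : ∀ {G Γ Δ a} → (eq a ε ∷ G) ⨾ Γ ⊢ Δ → G ⨾ ((a , ⊤*) ∷ Γ) ⊢ Δ
  ∧L    : ∀ {G Γ Δ a A B} → G ⨾ ((a , A) ∷ (a , B) ∷ Γ) ⊢ Δ → G ⨾ ((a , A ∧ B) ∷ Γ) ⊢ Δ
  ∧R    : ∀ {G Γ Δ a A B} → G ⨾ Γ ⊢ ((a , A) ∷ Δ) → G ⨾ Γ ⊢ ((a , B) ∷ Δ) →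
          G ⨾ Γ ⊢ ((a , A ∧ B) ∷ Δ)
  ⇒L    : ∀ {G Γ Δ a A B} → G ⨾ Γ ⊢ ((a , A) ∷ Δ) → G ⨾ ((a , B) ∷ Γ) ⊢ Δ →
          G ⨾ ((a , A ⇒ B) ∷ Γ) ⊢ Δ
  ⇒R    : ∀ {G Γ Δ a A B} → G ⨾ ((a , A) ∷ Γ) ⊢ ((a , B) ∷ Δ) → G ⨾ Γ ⊢ ((a , A ⇒ B) ∷ Δ)
  ⋆L    : ∀ {G Γ Δ x y z A B} →
          Fresh x G ((z , A ⋆ B) ∷ Γ) Δ → Fresh y G ((z , A ⋆ B) ∷ Γ) Δ → x ≢ y →
          (tern x y z ∷ G) ⨾ ((x , A) ∷ (y , B) ∷ Γ) ⊢ Δ →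
          G ⨾ ((z , A ⋆ B) ∷ Γ) ⊢ Δ
  -⋆R   : ∀ {G Γ Δ x y z A B} →
          Fresh x G Γ ((z , A -⋆ B) ∷ Δ) → Fresh y G Γ ((z , A -⋆ B) ∷ Δ) → x ≢ y →
          (tern x z y ∷ G) ⨾ ((x , A) ∷ Γ) ⊢ ((y , B) ∷ Δ) →
          G ⨾ Γ ⊢ ((z , A -⋆ B) ∷ Δ)
  ⋆R    : ∀ {G Γ Δ x y z w A B} → tern x y z ∈ G → E G z w →
          G ⨾ Γ ⊢ ((x , A) ∷ (w , A ⋆ B) ∷ Δ) →
          G ⨾ Γ ⊢ ((y , B) ∷ (w , A ⋆ B) ∷ Δ) →
          G ⨾ Γ ⊢ ((w , A ⋆ B) ∷ Δ)
  -⋆L   : ∀ {G Γ Δ x y z w A B} → tern x w y ∈ G → E G z w →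
          G ⨾ ((z , A -⋆ B) ∷ Γ) ⊢ ((x , A) ∷ Δ) →
          G ⨾ ((z , A -⋆ B) ∷ (y , B) ∷ Γ) ⊢ Δ →
          G ⨾ ((z , A -⋆ B) ∷ Γ) ⊢ Δ
  EM    : ∀ {G Γ Δ a b} → (eq a b ∷ G) ⨾ Γ ⊢ Δ → (neq a b ∷ G) ⨾ Γ ⊢ Δ → G ⨾ Γ ⊢ Δ
  -- structural rules synthesised from the PASL frame axioms
  Er    : ∀ {G Γ Δ x y z} → tern x y z ∈ G → E G y ε →
          (eq x z ∷ G) ⨾ Γ ⊢ Δ → G ⨾ Γ ⊢ Δ
  Ur    : ∀ {G Γ Δ x} → (tern x ε x ∷ G) ⨾ Γ ⊢ Δ → G ⨾ Γ ⊢ Δ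
  Comr  : ∀ {G Γ Δ x y z} → tern x y z ∈ G → (tern y x z ∷ G) ⨾ Γ ⊢ Δ → G ⨾ Γ ⊢ Δ
  Ar    : ∀ {G Γ Δ u v w x y y' z} → E G y y' → tern u y x ∈ G → tern v w y' ∈ G →
          Fresh z G Γ Δ →
          (tern z w x ∷ tern u v z ∷ G) ⨾ Γ ⊢ Δ → G ⨾ Γ ⊢ Δ
  Pr    : ∀ {G Γ Δ w w' x x' y z} → E G w w' → E G x x' →
          tern w x y ∈ G → tern w' x' z ∈ G →
          (eq y z ∷ G) ⨾ Γ ⊢ Δ → G ⨾ Γ ⊢ Δ
  Cr    : ∀ {G Γ Δ x x' y z z' w} → E G x x' → E G z z' →
          tern x y z ∈ G → tern x' w z' ∈ G →
          (eq y w ∷ G) ⨾ Γ ⊢ Δ → G ⨾ Γ ⊢ Δ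
  IU    : ∀ {G Γ Δ x y z} → tern x y z ∈ G → E G z ε →
          (eq x ε ∷ G) ⨾ Γ ⊢ Δ → G ⨾ Γ ⊢ Δ

Provable : Formula → Set
Provable F = Σ Label λ w → (w ≢ ε) × ([] ⨾ [] ⊢ ((w , F) ∷ []))

module Submission where

-- Reading the sequent bottom-up, ⊤* ∧ (A ⋆ B) at a world w
-- tells us w = ε and w splits as (x , y ▷ w).  Indivisibility of the unit
-- (rule IU) then forces x = ε, so x = w, and the hypothesis x : A closes the
-- goal w : A by an identity axiom at two E-equal labels.
--
-- The calculus only has identity for propositional variables, so the file
-- first derives the generalised identity  a : F ⊢ b : F  (whenever
-- E(G) ⊢ a = b) for every formula F by induction on F.

open import Defs
open import Data.Nat using (suc; _⊔_; _≤_)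
open import Data.Nat.Properties using (≤-trans; m≤m⊔n; m≤n⊔m; <-irrefl)
open import Data.List using (List; []; _∷_; foldr)
open import Data.List.Membership.Propositional using (_∈_; _∉_)
open import Data.List.Relation.Unary.Any using (here; there)
open import Data.List.Relation.Binary.Subset.Propositional using (_⊆_)
open import Data.Product using (_,_)
open import Relation.Binary.PropositionalEquality using (_≢_; refl; subst)

maxLabel : List Label → Label
maxLabel = foldr _⊔_ 0

≤maxLabel : ∀ {n} L → n ∈ L → n ≤ maxLabel L
≤maxLabel (x ∷ L) (here refl) = m≤m⊔n x (maxLabel L)
≤maxLabel (x ∷ L) (there n∈L) = ≤-trans (≤maxLabel L n∈L) (m≤n⊔m x (maxLabel L))

fresh : List Label → Label
fresh L = suc (maxLabel L)

fresh∉ : ∀ L → fresh L ∉ L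
fresh∉ L fresh∈L = <-irrefl refl (≤maxLabel L fresh∈L)

fresh₂ : List Label → Label
fresh₂ L = fresh (fresh L ∷ L)

fresh≢fresh₂ : ∀ L → fresh L ≢ fresh₂ L
fresh≢fresh₂ L same = fresh∉ (fresh L ∷ L) (subst (_∈ (fresh L ∷ L)) same (here refl))

freshFor : ∀ G Γ Δ → Fresh (fresh (labelsSeq G Γ Δ)) G Γ Δ
freshFor G Γ Δ = (λ ()) , fresh∉ (labelsSeq G Γ Δ)

fresh₂For : ∀ G Γ Δ → Fresh (fresh₂ (labelsSeq G Γ Δ)) G Γ Δ
fresh₂For G Γ Δ = (λ ()) , λ x∈L → fresh∉ (fresh L ∷ L) (there x∈L)
  where L = labelsSeq G Γ Δ

⋆L-fresh : ∀ {G Γ Δ z A B} →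
           let L = labelsSeq G ((z , A ⋆ B) ∷ Γ) Δ in
           (tern (fresh L) (fresh₂ L) z ∷ G) ⨾ ((fresh L , A) ∷ (fresh₂ L , B) ∷ Γ) ⊢ Δ →
           G ⨾ ((z , A ⋆ B) ∷ Γ) ⊢ Δ
⋆L-fresh {G} {Γ} {Δ} {z} {A} {B} =
  ⋆L (freshFor G Γ′ Δ) (fresh₂For G Γ′ Δ) (fresh≢fresh₂ (labelsSeq G Γ′ Δ))
  where Γ′ = (z , A ⋆ B) ∷ Γ

-⋆R-fresh : ∀ {G Γ Δ z A B} →
            let L = labelsSeq G Γ ((z , A -⋆ B) ∷ Δ) in
            (tern (fresh L) z (fresh₂ L) ∷ G) ⨾ ((fresh L , A) ∷ Γ) ⊢ ((fresh₂ L , B) ∷ Δ) →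
            G ⨾ Γ ⊢ ((z , A -⋆ B) ∷ Δ)
-⋆R-fresh {G} {Γ} {Δ} {z} {A} {B} =
  -⋆R (freshFor G Γ Δ′) (fresh₂For G Γ Δ′) (fresh≢fresh₂ (labelsSeq G Γ Δ′))
  where Δ′ = (z , A -⋆ B) ∷ Δ

E-mono : ∀ {G G' a b} → G ⊆ G' → E G a b → E G' a b
E-mono G⊆G' (e-base a=b∈G) = e-base (G⊆G' a=b∈G)
E-mono G⊆G' e-refl          = e-refl
E-mono G⊆G' (e-sym p)       = e-sym (E-mono G⊆G' p)
E-mono G⊆G' (e-trans p q)   = e-trans (E-mono G⊆G' p) (E-mono G⊆G' q)

E-weaken : ∀ {G r a b} → E G a b → E (r ∷ G) a b
E-weaken = E-mono there

-- Since contexts are sets, a formula already present in Γ (resp. Δ) may be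
-- put in front, where the logical rules expect their principal formula.
absorbL : ∀ {G Γ Δ f} → f ∈ Γ → G ⨾ (f ∷ Γ) ⊢ Δ → G ⨾ Γ ⊢ Δ
absorbL f∈Γ = reorg (λ p → p) (λ p → p) (λ { (here refl) → f∈Γ ; (there p) → p }) there
                    (λ p → p) (λ p → p)

absorbR : ∀ {G Γ Δ f} → f ∈ Δ → G ⨾ Γ ⊢ (f ∷ Δ) → G ⨾ Γ ⊢ Δ
absorbR f∈Δ = reorg (λ p → p) (λ p → p) (λ p → p) (λ p → p)
                    (λ { (here refl) → f∈Δ ; (there p) → p }) there

-- Each connective is decomposed on both sides and
-- the immediate subformulae are closed by induction (for ⋆ and -⋆ at the
-- same fresh labels, using the relational atom just introduced).
identity : ∀ F {G Γ Δ a b} → (a , F) ∈ Γ → (b , F) ∈ Δ → E G a b → G ⨾ Γ ⊢ Δ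
identity (var p) a∈Γ b∈Δ a=b = id a∈Γ b∈Δ a=b
identity ⊤ᶠ      a∈Γ b∈Δ a=b = ⊤R b∈Δ
identity ⊥ᶠ      a∈Γ b∈Δ a=b = ⊥L a∈Γ
identity ⊤*      a∈Γ b∈Δ a=b =
  absorbL a∈Γ (⊤*L (⊤*R b∈Δ (e-trans (e-sym (E-weaken a=b)) (e-base (here refl)))))
identity (A ∧ B) a∈Γ b∈Δ a=b = absorbL a∈Γ (∧L (absorbR b∈Δ (∧R
  (identity A (here refl) (here refl) a=b)
  (identity B (there (here refl)) (here refl) a=b))))
identity (A ⇒ B) a∈Γ b∈Δ a=b = absorbR b∈Δ (⇒R (absorbL (there a∈Γ) (⇒L
  (identity A (here refl) (here refl) (e-sym a=b))
  (identity B (here refl) (here refl) a=b))))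
identity (A ⋆ B) a∈Γ b∈Δ a=b = absorbL a∈Γ (⋆L-fresh (absorbR b∈Δ
  (⋆R (here refl) (E-weaken a=b)
    (identity A (here refl) (here refl) e-refl)
    (identity B (there (here refl)) (here refl) e-refl))))
identity (A -⋆ B) a∈Γ b∈Δ a=b = absorbR b∈Δ (-⋆R-fresh (absorbL (there a∈Γ)
  (-⋆L (here refl) (E-weaken a=b)
    (identity A (there (here refl)) (here refl) e-refl)
    (identity B (there (here refl)) (here refl) e-refl))))

-- Derivation at world 1:  ⇒R, ∧L, ⊤*L (1 = ε), ⋆L (x , y ▷ 1),
-- IU (x = ε, as 1 = ε), and identity for A at x and 1, since x = ε = 1.
proposition4p1 : ∀ (A B : Formula) → Provable ((⊤* ∧ (A ⋆ B)) ⇒ A)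
proposition4p1 A B = 1 , (λ ()) , ⇒R (∧L (⊤*L (⋆L-fresh
  (IU (here refl) 1=ε (identity A (here refl) (here refl) x=1)))))
  where
  1=ε : ∀ {r} → E (r ∷ eq 1 ε ∷ []) 1 ε
  1=ε = E-weaken (e-base (here refl))

  x=1 : ∀ {x r} → E (eq x ε ∷ r ∷ eq 1 ε ∷ []) x 1
  x=1 = e-trans (e-base (here refl)) (e-sym (E-weaken 1=ε))
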